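{- Let $P=(L,\ell_0,G,\ell_\mathrm{err})$ and $P'=(L',\ell'_0,G',\ell'_\mathrm{err})$ be deterministic CFAs and let $(N,E,n_0,\Delta)$ be the graph returned by Algorithm DD (described in the context) on input $(P,P')$. For every $\pi'=(\ell'_0,c'_0)\xrightarrow{g'_1}(\ell'_1,c'_1)\cdots\xrightarrow{g'_n}(\ell'_n,c'_n)\in paths^\mathrm{rb}(P,P')$ and every $0\le k\le n$: if $n_0\xrightarrow{g'_1}n_1\cdots\xrightarrow{g'_k}n_k$ and $n'_0\xrightarrow{g'_1}n'_1\cdots\xrightarrow{g'_k}n'_k$ are both sequences of edges of $E$ (i.e. $(n_{i-1},g'_i,n_i)\in E$ and $(n'_{i-1},g'_i,n'_i)\in E$ for all $1\le i\le k$) with $n'_0=n_0$, then $n_i=n'_i$ for all $0\le i\le k$.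
   Context: Programs operate on variables; a concrete data state $c$ assigns a value to every variable. $Ops$ is a set of operations, each either an assignment or an assume operation. An assume operation $op$ is a predicate on data states (write $c\models op$); $op$ is satisfiable if some data state satisfies it; for assume operations, $op'\Rightarrow op$ means every data state satisfying $op'$ satisfies $op$, and $op_1\equiv\neg op_2$ means $op_1$ holds exactly where $op_2$ does not. For an assignment $op$, $SP_{op}(c)$ denotes the data state after executing $op$ in $c$. $wr(op)$ is the set of variables whose value $op$ may change. $rd(op)$ is a set of variables such that whenever $c,c'$ agree on $rd(op)$, then for an assume $op$: $c\models op\iff c'\models op$, and for an assignment $op$: $SP_{op}(c)$ and $SP_{op}(c')$ agree on $wr(op)$. A CFA $P=(L,\ell_0,G,\ell_\mathrm{err})$ consists of locations $L$, initial location $\ell_0$, error location $\ell_\mathrm{err}$, edges $G\subseteq L\times Ops\times L$. $P$ is deterministic if for all $(\ell,op_1,\ell_1),(\ell,op_2,\ell_2)\in G$ either $op_1=op_2$ and $\ell_1=\ell_2$, or $op_1,op_2$ are assume operations with $op_1\equiv\neg op_2$. An executable path of $P$ is $(\ell_0,c_0)\xrightarrow{g_1}(\ell_1,c_1)\cdots\xrightarrow{g_n}(\ell_n,c_n)$, $n\ge0$, with arbitrary $c_0$, $g_i=(\ell_{i-1},op_i,\ell_i)\in G$, and: for an assume $op_i$, $c_{i-1}\models op_i$ and $c_i=c_{i-1}$; for an assignment, $c_i=SP_{op_i}(c_{i-1})$. $paths^\mathrm{err}(P)$: executable paths visiting $\ell_\mathrm{err}$. $paths^\mathrm{rb}(P,P')$: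 the $\pi'\in paths^\mathrm{err}(P')$ such that no $\pi\in paths^\mathrm{err}(P)$ has the same initial data state. Algorithm DD (input: deterministic CFAs $P,P'$). Nodes are either pairs in $L\times L'$ or single locations in $L'$ (distinct kinds). It maintains sets $waitlist,visited\subseteq L\times L'$, $\Delta\subseteq L'$, a set $edges$ of triples $(p,g',s)$ with $p\in L\times L'$, $g'\in G'$, $s\in(L\times L')\cup L'$, and a map $modif$ from $L\times L'$ to sets of variables. Initially $waitlist=visited=\{(\ell_0,\ell'_0)\}$, $edges=\Delta=\emptyset$, $modif(x)=\emptyset$ for all $x$. Subroutine PROCESS$(p,g',s,V)$: (a) if $s\in L'$: add $s$ to $\Delta$, add $(p,g',s)$ to $edges$, remove from $visited$ and $waitlist$ every pair with second component $s$. (b) Otherwise $s=(\ell,\ell')$. If $\ell\ne\ell_\mathrm{err}$ and $\ell'=\ell'_\mathrm{err}$, call PROCESS$(p,g',\ell'_\mathrm{err},\emptyset)$. Otherwise: if $\ell'\notin\Delta$, $\ell\ne\ell_\mathrm{err}$ and ($s\notin visited$ or $V\not\subseteq modif(s)$), add $s$ to $waitlist$; then if $\ell'\notin\Delta$, add $s$ to $visited$ and set $modif(s):=modif(s)\cup V$; finally add $(p,g',s)$ to $edges$. Main loop: while $waitlist\ne\emptyset$, remove some $(\ell_1,\ell'_1)$ from $waitlist$; for each $g'=(\ell'_1,op',\ell'_2)\in G'$, with $M$ the current value of $modif((\ell_1,\ell'_1))$: (1) if $op'$ is an assignment: if some $(\ell_1,op',\ell_2)\in G$ exists, let $V=M\cup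 wr(op')$ if $M\cap rd(op')\ne\emptyset$ and $V=M\setminus wr(op')$ otherwise, and call PROCESS$((\ell_1,\ell'_1),g',(\ell_2,\ell'_2),V)$; otherwise call PROCESS$((\ell_1,\ell'_1),g',(\ell_1,\ell'_2),M\cup wr(op'))$. (2) if $op'$ is an assume: set $\ell_p:=\ell_1$, $V:=M$; while $\ell_p\ne\ell_\mathrm{err}$ and some $(\ell_p,op_a,\ell_s)\in G$ with $op_a$ an assignment exists, set $\ell_p:=\ell_s$, $V:=V\cup wr(op_a)$. Then, if $\ell_p\ne\ell_\mathrm{err}$ and some $(\ell_p,op,\ell_2)\in G$ exists with $op=op'$ or ($op'\Rightarrow op$ and $op'$ satisfiable): if $V\cap(rd(op)\cup rd(op'))\ne\emptyset$ call PROCESS$((\ell_1,\ell'_1),g',\ell'_2,\emptyset)$, else call PROCESS$((\ell_1,\ell'_1),g',(\ell_2,\ell'_2),V)$; otherwise call PROCESS$((\ell_1,\ell'_1),g',(\ell_p,\ell'_2),V)$. After the loop: if $\ell'_0\in\Delta$, or $\ell'_0=\ell'_\mathrm{err}$ and $\ell_0\ne\ell_\mathrm{err}$, return $(\{\ell'_0\},\emptyset,\ell'_0,\{\ell'_0\})$. Otherwise return $(visited\cup\Delta,E,(\ell_0,\ell'_0),\Delta)$ where $E$ is the set of $(n,g',n')$ with $n\in visited$, $g'\in G'$, $n'\in visited\cup\Delta$, such that $(n,g',n')\in edges$, or $n'\in\Delta$ and $(n,g',(\ell,n'))\in edges$ for some $\ell\in L$. -}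

module Defs where

open import Data.Nat using (ℕ; zero; suc; _<_; _≤_)
open import Data.Fin using (Fin; toℕ)
open import Data.List using (List; []; _∷_; length; lookup)
open import Data.List.Membership.Propositional using (_∈_)
open import Data.List.Relation.Unary.Any using (Any)
open import Data.List.Relation.Unary.Unique.Propositional using (Unique)
open import Data.Product using (Σ; ∃; _×_; _,_; proj₁; proj₂)
open import Data.Sum using (_⊎_)
open import Data.Empty using (⊥)
open import Relation.Nullary using (¬_)
open import Relation.Binary.PropositionalEquality using (_≡_; _≢_)

data Op (Asg Asm : Set) : Set where
  assign : Asg → Op Asg Asm
  assume : Asm → Op Asg Asm

record Lang : Set₁ where
  field
    Var Val Asg Asm : Set
  State : Set
  State = Var → Val
  Ops : Set
  Ops = Op Asg Asm
  field
    SP  : Asg → State → State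
    _⊨_ : State → Asm → Set
    wr  : Ops → Var → Set
    rd  : Ops → Var → Set
    wr-spec : ∀ a c v → ¬ wr (assign a) v → SP a c v ≡ c v
    rd-assume : ∀ a c c' → (∀ v → rd (assume a) v → c v ≡ c' v) →
                (c ⊨ a → c' ⊨ a) × (c' ⊨ a → c ⊨ a)
    rd-assign : ∀ a c c' → (∀ v → rd (assign a) v → c v ≡ c' v) →
                ∀ v → wr (assign a) v → SP a c v ≡ SP a c' v

record Edge (L O : Set) : Set where
  constructor edge
  field
    src : L
    op  : O
    tgt : L
open Edge public

record CFA (𝓛 : Lang) : Set₁ where
  field
    Loc  : Set
    ℓ₀   : Loc
    ℓerr : Loc
    G    : List (Edge Loc (Lang.Ops 𝓛))

module _ {𝓛 : Lang} where
  open Lang 𝓛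

  Sat : Ops → Set
  Sat (assume a) = ∃ λ c → c ⊨ a
  Sat (assign _) = ⊥

  _⇒ₒ_ : Ops → Ops → Set
  assume a ⇒ₒ assume b = ∀ c → c ⊨ a → c ⊨ b
  _ ⇒ₒ _ = ⊥

  _≡¬_ : Ops → Ops → Set
  assume a ≡¬ assume b = ∀ c → (c ⊨ a → ¬ (c ⊨ b)) × (¬ (c ⊨ b) → c ⊨ a)
  _ ≡¬ _ = ⊥

  Deterministic : CFA 𝓛 → Set
  Deterministic P = ∀ {g₁ g₂} → g₁ ∈ G → g₂ ∈ G → src g₁ ≡ src g₂ →
      (op g₁ ≡ op g₂ × tgt g₁ ≡ tgt g₂) ⊎ (op g₁ ≡¬ op g₂)
    where open CFA P

  -- Executable path starting in location l with initial data state c,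
  -- following the edge list (the data states are determined by c and the edges).
  data Exec (P : CFA 𝓛) : CFA.Loc P → State → List (Edge (CFA.Loc P) Ops) → Set where
    []  : ∀ {l c} → Exec P l c []
    asm : ∀ {l l' a c gs} → edge l (assume a) l' ∈ CFA.G P → c ⊨ a →
          Exec P l' c gs → Exec P l c (edge l (assume a) l' ∷ gs)
    asg : ∀ {l l' a c gs} → edge l (assign a) l' ∈ CFA.G P →
          Exec P l' (SP a c) gs → Exec P l c (edge l (assign a) l' ∷ gs)

  ErrPath : (P : CFA 𝓛) → State → List (Edge (CFA.Loc P) Ops) → Set
  ErrPath P c gs = Exec P ℓ₀ c gs × (ℓ₀ ≡ ℓerr ⊎ Any (λ g → tgt g ≡ ℓerr) gs)
    where open CFA P

  RB : (P P' : CFA 𝓛) → State → List (Edge (CFA.Loc P') Ops) → Set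
  RB P P' c gs = ErrPath P' c gs × ¬ (∃ λ hs → ErrPath P c hs)

-- Algorithm DD, as a (nondeterministic) relational semantics.

module DD {𝓛 : Lang} (P P' : CFA 𝓛) where
  open Lang 𝓛
  open CFA P  renaming (Loc to L; ℓ₀ to l₀; ℓerr to le; G to G)
  open CFA P' renaming (Loc to L'; ℓ₀ to l₀'; ℓerr to le'; G to G')

  VS : Set₁
  VS = Var → Set

  Pair : Set
  Pair = L × L'

  data Node : Set where
    pair   : L → L' → Node
    single : L' → Node

  E' : Set
  E' = Edge L' Ops

  record St : Set₁ where
    field
      waitlist : Pair → Set
      visited  : Pair → Set
      Δ        : L' → Set
      edges    : Pair → E' → Node → Set
      modif    : Pair → VS
  open St public

  init : St
  init = record
    { waitlist = λ x → x ≡ (l₀ , l₀')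
    ; visited  = λ x → x ≡ (l₀ , l₀')
    ; Δ        = λ _ → ⊥
    ; edges    = λ _ _ _ → ⊥
    ; modif    = λ _ _ → ⊥ }

  -- update of case (b) of PROCESS (when not redirected to ℓ'err)
  updB : St → Pair → E' → L → L' → VS → St
  updB st p g l l' V = record
    { waitlist = λ x → waitlist st x ⊎
        (x ≡ (l , l') × ¬ Δ st l' × l ≢ le ×
          (¬ visited st (l , l') ⊎ ¬ (∀ v → V v → modif st (l , l') v)))
    ; visited  = λ x → visited st x ⊎ (x ≡ (l , l') × ¬ Δ st l')
    ; Δ        = Δ st
    ; edges    = λ q h n → edges st q h n ⊎ (q ≡ p × h ≡ g × n ≡ pair l l')
    ; modif    = λ x v → modif st x v ⊎ (x ≡ (l , l') × ¬ Δ st l' × V v) }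

  data Proc (st : St) (p : Pair) (g : E') : Node → VS → St → Set₁ where
    caseA  : ∀ {l' V} → Proc st p g (single l') V (record st
               { Δ        = λ x → Δ st x ⊎ x ≡ l'
               ; edges    = λ q h n → edges st q h n ⊎ (q ≡ p × h ≡ g × n ≡ single l')
               ; visited  = λ x → visited st x × proj₂ x ≢ l'
               ; waitlist = λ x → waitlist st x × proj₂ x ≢ l' })
    caseB1 : ∀ {l l' V st'} → l ≢ le → l' ≡ le' →
             Proc st p g (single le') (λ _ → ⊥) st' → Proc st p g (pair l l') V st'
    caseB2 : ∀ {l l' V} → ¬ (l ≢ le × l' ≡ le') →
             Proc st p g (pair l l') V (updB st p g l l' V)

  -- the inner while-loop of step (2): follow assignment edges of P
  data Chase : L → VS → L → VS → Set₁ where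
    stop : ∀ {lp V} → (lp ≡ le ⊎ ¬ (∃ λ a → ∃ λ ls → edge lp (assign a) ls ∈ G)) →
           Chase lp V lp V
    go   : ∀ {lp ls a V lf Vf} → lp ≢ le → edge lp (assign a) ls ∈ G →
           Chase ls (λ v → V v ⊎ wr (assign a) v) lf Vf → Chase lp V lf Vf

  Match : Ops → Ops → Set
  Match op op' = op ≡ op' ⊎ (_⇒ₒ_ {𝓛} op' op × Sat {𝓛} op')

  data Handle (st : St) : Pair → E' → St → Set₁ where
    asgYes : ∀ {l1 l1' a l2' l2 st'} → edge l1 (assign a) l2 ∈ G →
      Proc st (l1 , l1') (edge l1' (assign a) l2') (pair l2 l2')
        (λ v → ((∃ λ u → modif st (l1 , l1') u × rd (assign a) u) ×
                  (modif st (l1 , l1') v ⊎ wr (assign a) v))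
             ⊎ (¬ (∃ λ u → modif st (l1 , l1') u × rd (assign a) u) ×
                  modif st (l1 , l1') v × ¬ wr (assign a) v)) st' →
      Handle st (l1 , l1') (edge l1' (assign a) l2') st'
    asgNo : ∀ {l1 l1' a l2' st'} → ¬ (∃ λ l2 → edge l1 (assign a) l2 ∈ G) →
      Proc st (l1 , l1') (edge l1' (assign a) l2') (pair l1 l2')
        (λ v → modif st (l1 , l1') v ⊎ wr (assign a) v) st' →
      Handle st (l1 , l1') (edge l1' (assign a) l2') st'
    asmDiff : ∀ {l1 l1' a l2' lp V op l2 st'} →
      Chase l1 (modif st (l1 , l1')) lp V → lp ≢ le →
      edge lp op l2 ∈ G → Match op (assume a) →
      (∃ λ v → V v × (rd op v ⊎ rd (assume a) v)) →
      Proc st (l1 , l1') (edge l1' (assume a) l2') (single l2') (λ _ → ⊥) st' →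
      Handle st (l1 , l1') (edge l1' (assume a) l2') st'
    asmSame : ∀ {l1 l1' a l2' lp V op l2 st'} →
      Chase l1 (modif st (l1 , l1')) lp V → lp ≢ le →
      edge lp op l2 ∈ G → Match op (assume a) →
      ¬ (∃ λ v → V v × (rd op v ⊎ rd (assume a) v)) →
      Proc st (l1 , l1') (edge l1' (assume a) l2') (pair l2 l2') V st' →
      Handle st (l1 , l1') (edge l1' (assume a) l2') st'
    asmNone : ∀ {l1 l1' a l2' lp V st'} →
      Chase l1 (modif st (l1 , l1')) lp V →
      ¬ (lp ≢ le × ∃ λ op → ∃ λ l2 → edge lp op l2 ∈ G × Match op (assume a)) →
      Proc st (l1 , l1') (edge l1' (assume a) l2') (pair lp l2') V st' →
      Handle st (l1 , l1') (edge l1' (assume a) l2') st'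

  data HandleAll (p : Pair) : St → List E' → St → Set₁ where
    []  : ∀ {st} → HandleAll p st [] st
    _∷_ : ∀ {st st₁ st₂ g gs} → Handle st p g st₁ → HandleAll p st₁ gs st₂ →
          HandleAll p st (g ∷ gs) st₂

  removeW : St → Pair → St
  removeW st p = record st { waitlist = λ x → waitlist st x × x ≢ p }

  -- one iteration of the main loop: remove some pair from the waitlist and
  -- process all outgoing edges of its P'-location (in some order, each once)
  data Step : St → St → Set₁ where
    step : ∀ {st l1 l1' gs st'} → waitlist st (l1 , l1') → Unique gs →
      (∀ g → (g ∈ gs → g ∈ G' × src g ≡ l1') × (g ∈ G' → src g ≡ l1' → g ∈ gs)) →
      HandleAll (l1 , l1') (removeW st (l1 , l1')) gs st' → Step st st'

  data Steps : St → St → Set₁ where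
    done : ∀ {st} → Steps st st
    more : ∀ {st st₁ st₂} → Step st st₁ → Steps st₁ st₂ → Steps st st₂

  InN : St → Node → Set
  InN st (pair l l') = visited st (l , l')
  InN st (single l') = Δ st l'

  Eout : St → Node → E' → Node → Set
  Eout st (pair l l') g n' = visited st (l , l') × g ∈ G' × InN st n' ×
    (edges st (l , l') g n' ⊎
      (∃ λ m → n' ≡ single m × Δ st m × ∃ λ l2 → edges st (l , l') g (pair l2 m)))
  Eout st (single _) _ _ = ⊥

  TrivCond : St → Set
  TrivCond st = Δ st l₀' ⊎ (l₀' ≡ le' × l₀ ≢ le)

  data Returns (st : St) : Node → (Node → E' → Node → Set) → Set₁ where
    trivial : TrivCond st → Returns st (single l₀') (λ _ _ _ → ⊥)
    graph   : ¬ TrivCond st → Returns st (pair l₀ l₀') (Eout st)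

  Output : Node → (Node → E' → Node → Set) → Set₁
  Output n₀ E = Σ St λ st → Steps init st × (∀ x → ¬ waitlist st x) × Returns st n₀ E

{-# OPTIONS --safe #-}
module Submission where

-- The graph returned by DD is deterministic: every recorded edge leaving a pair (ℓ, ℓ') along
-- g' = (ℓ', op', ℓ'₂) has P'-component ℓ'₂, and its P-component (if any) is the unique location
-- reached from ℓ by the rule of DD for op', unique because P is deterministic. This survives every
-- run of the main loop, together with the fact that no visited pair has its P'-location in Δ, so a
-- pair node and a single node never compete as targets. Two walks from n₀ along the same edge
-- labels then agree step by step.

open import Defs
open import Data.Nat using (ℕ; zero; suc; _<_; _≤_)
open import Data.Nat.Properties using (<-≤-trans; <⇒≤)
open import Data.Fin using (Fin; toℕ; fromℕ<)
open import Data.Fin.Properties using (toℕ-fromℕ<)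
open import Data.List using (List; length; lookup)
open import Data.List.Membership.Propositional using (_∈_)
open import Data.Product using (∃; _×_; _,_; proj₁; proj₂)
open import Data.Sum using (_⊎_; inj₁; inj₂)
open import Data.Empty using (⊥; ⊥-elim)
open import Relation.Nullary using (¬_)
open import Relation.Binary.PropositionalEquality
  using (_≡_; _≢_; refl; sym; trans; cong; cong₂; subst)

Functional : {A B : Set} → (A → B → A → Set) → Set
Functional E = ∀ {n g n₁ n₂} → E n g n₁ → E n g n₂ → n₁ ≡ n₂

module _ {A B : Set} {E : A → B → A → Set} (E-functional : Functional E)
         (gs : List B) {k : ℕ} (k≤len : k ≤ length gs) (ns ns' : ℕ → A) where

  WalkAlong : (ℕ → A) → Set
  WalkAlong ms = ∀ (i : Fin (length gs)) → toℕ i < k →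
    E (ms (toℕ i)) (lookup gs i) (ms (suc (toℕ i)))

  functional-walks-agree : ns 0 ≡ ns' 0 → WalkAlong ns → WalkAlong ns' →
    (i : ℕ) → i ≤ k → ns i ≡ ns' i
  functional-walks-agree ns₀≡ _ _ zero _ = ns₀≡
  functional-walks-agree ns₀≡ walk walk' (suc i) i<k =
    agree-next (fromℕ< (<-≤-trans i<k k≤len)) (toℕ-fromℕ< (<-≤-trans i<k k≤len))
      (functional-walks-agree ns₀≡ walk walk' i (<⇒≤ i<k))
    where
      agree-next : (j : Fin (length gs)) → toℕ j ≡ i → ns i ≡ ns' i → ns (suc i) ≡ ns' (suc i)
      agree-next j refl agree-now = E-functional (walk j i<k)
        (subst (λ n → E n (lookup gs j) (ns' (suc i))) (sym agree-now) (walk' j i<k))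

module _ {𝓛 : Lang} (P P' : CFA 𝓛) (P-deterministic : Deterministic P) where
  open Lang 𝓛
  open DD P P'
  open CFA P using (G; ℓerr)

  chase-functional : ∀ {lp V V' lf Vf lf' Vf'} → Chase lp V lf Vf → Chase lp V' lf' Vf' → lf ≡ lf'
  chase-functional (stop _) (stop _) = refl
  chase-functional (stop (inj₁ lp≡err)) (go lp≢err _ _) = ⊥-elim (lp≢err lp≡err)
  chase-functional (stop (inj₂ no-asg)) (go _ g∈G _) = ⊥-elim (no-asg (_ , _ , g∈G))
  chase-functional (go lp≢err _ _) (stop (inj₁ lp≡err)) = ⊥-elim (lp≢err lp≡err)
  chase-functional (go _ g∈G _) (stop (inj₂ no-asg)) = ⊥-elim (no-asg (_ , _ , g∈G))
  chase-functional (go _ g∈G ch) (go _ g∈G' ch') with P-deterministic g∈G g∈G' refl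
  ... | inj₁ (_ , refl) = chase-functional ch ch'
  ... | inj₂ ()

  Match⇒entails : ∀ {a b} → Match (assume b) (assume a) → ∀ c → c ⊨ a → c ⊨ b
  Match⇒entails (inj₁ refl) _ c⊨a = c⊨a
  Match⇒entails (inj₂ (a⇒b , _)) c c⊨a = a⇒b c c⊨a

  -- An assume that is its own negation is refuted only at some data state, hence the argument c.
  Match-¬complementary : State → ∀ {a op₁ op₂} → Match op₁ (assume a) → Match op₂ (assume a) →
    ¬ (_≡¬_ {𝓛} op₁ op₂)
  Match-¬complementary _ {op₁ = assign _} _ _ ()
  Match-¬complementary _ {op₁ = assume _} {assign _} _ _ ()
  Match-¬complementary c {a} {assume _} {assume _} (inj₁ refl) (inj₁ refl) a≡¬a =
    c⊭a (proj₂ (a≡¬a c) c⊭a)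
    where
      c⊭a : ¬ (c ⊨ a)
      c⊭a c⊨a = proj₁ (a≡¬a c) c⊨a c⊨a
  Match-¬complementary _ {op₁ = assume _} {assume _} m₁@(inj₂ (_ , c , c⊨a)) m₂ neg =
    proj₁ (neg c) (Match⇒entails m₁ c c⊨a) (Match⇒entails m₂ c c⊨a)
  Match-¬complementary _ {op₁ = assume _} {assume _} m₁@(inj₁ refl) m₂@(inj₂ (_ , c , c⊨a)) neg =
    proj₁ (neg c) (Match⇒entails m₁ c c⊨a) (Match⇒entails m₂ c c⊨a)

  -- The P-location that DD pairs with the target of g' when g' leaves a pair (l₁, src g').
  data Successor (l₁ : CFA.Loc P) : E' → CFA.Loc P → Set₁ where
    asgYes  : ∀ {s a t l₂} → edge l₁ (assign a) l₂ ∈ G → Successor l₁ (edge s (assign a) t) l₂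
    asgNo   : ∀ {s a t} → ¬ (∃ λ l₂ → edge l₁ (assign a) l₂ ∈ G) →
              Successor l₁ (edge s (assign a) t) l₁
    asmStep : ∀ {s a t lp V₀ V l₂ op} → Chase l₁ V₀ lp V → lp ≢ ℓerr → edge lp op l₂ ∈ G →
              Match op (assume a) → Successor l₁ (edge s (assume a) t) l₂
    asmStay : ∀ {s a t lp V₀ V} → Chase l₁ V₀ lp V →
              ¬ (lp ≢ ℓerr × ∃ λ op → ∃ λ l₂ → edge lp op l₂ ∈ G × Match op (assume a)) →
              Successor l₁ (edge s (assume a) t) lp

  Successor-functional : State → ∀ {l₁ g x y} → Successor l₁ g x → Successor l₁ g y → x ≡ y
  Successor-functional _ (asgYes g∈G) (asgYes g∈G') with P-deterministic g∈G g∈G' refl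
  ... | inj₁ (_ , x≡y) = x≡y
  ... | inj₂ ()
  Successor-functional _ (asgYes g∈G) (asgNo none) = ⊥-elim (none (_ , g∈G))
  Successor-functional _ (asgNo none) (asgYes g∈G) = ⊥-elim (none (_ , g∈G))
  Successor-functional _ (asgNo _) (asgNo _) = refl
  Successor-functional c (asmStep ch _ g∈G m) (asmStep ch' _ g∈G' m')
    with refl ← chase-functional ch ch'
    with P-deterministic g∈G g∈G' refl
  ... | inj₁ (_ , x≡y) = x≡y
  ... | inj₂ neg = ⊥-elim (Match-¬complementary c m m' neg)
  Successor-functional _ (asmStep ch lp≢err g∈G m) (asmStay ch' none)
    with refl ← chase-functional ch ch' = ⊥-elim (none (lp≢err , _ , _ , g∈G , m))
  Successor-functional _ (asmStay ch none) (asmStep ch' lp≢err g∈G m)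
    with refl ← chase-functional ch ch' = ⊥-elim (none (lp≢err , _ , _ , g∈G , m))
  Successor-functional _ (asmStay ch _) (asmStay ch' _) = chase-functional ch ch'

  data WellFormedTarget (l₁ : CFA.Loc P) (g : E') : Node → Set₁ where
    single : ∀ {m} → m ≡ tgt g → WellFormedTarget l₁ g (single m)
    pair   : ∀ {x m} → m ≡ tgt g → Successor l₁ g x → WellFormedTarget l₁ g (pair x m)

  record Invariant (st : St) : Set₁ where
    field
      edges-wellFormed : ∀ {l₁ l₁' g n} → edges st (l₁ , l₁') g n → WellFormedTarget l₁ g n
      visited-∉Δ       : ∀ {x m} → visited st (x , m) → ¬ Δ st m
  open Invariant

  init-invariant : Invariant init
  init-invariant = record { edges-wellFormed = λ () ; visited-∉Δ = λ _ () }

  Proc-invariant : ∀ {st l₁ l₁' g s V st'} → Invariant st → WellFormedTarget l₁ g s →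
    Proc st (l₁ , l₁') g s V st' → Invariant st'
  Proc-invariant I wf caseA = record
    { edges-wellFormed = λ { (inj₁ e) → edges-wellFormed I e ; (inj₂ (refl , refl , refl)) → wf }
    ; visited-∉Δ = λ { (v , _) (inj₁ d) → visited-∉Δ I v d ; (_ , m≢l') (inj₂ refl) → m≢l' refl } }
  Proc-invariant I (pair m≡tgt _) (caseB1 _ m≡err proc) =
    Proc-invariant I (single (trans (sym m≡err) m≡tgt)) proc
  Proc-invariant I wf (caseB2 _) = record
    { edges-wellFormed = λ { (inj₁ e) → edges-wellFormed I e ; (inj₂ (refl , refl , refl)) → wf }
    ; visited-∉Δ = λ { (inj₁ v) d → visited-∉Δ I v d ; (inj₂ (refl , m∉Δ)) d → m∉Δ d } }

  Handle-invariant : ∀ {st p g st'} → Invariant st → Handle st p g st' → Invariant st'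
  Handle-invariant I (asgYes g∈G proc) = Proc-invariant I (pair refl (asgYes g∈G)) proc
  Handle-invariant I (asgNo none proc) = Proc-invariant I (pair refl (asgNo none)) proc
  Handle-invariant I (asmDiff _ _ _ _ _ proc) = Proc-invariant I (single refl) proc
  Handle-invariant I (asmSame ch lp≢err g∈G m _ proc) =
    Proc-invariant I (pair refl (asmStep ch lp≢err g∈G m)) proc
  Handle-invariant I (asmNone ch none proc) = Proc-invariant I (pair refl (asmStay ch none)) proc

  HandleAll-invariant : ∀ {p st gs st'} → Invariant st → HandleAll p st gs st' → Invariant st'
  HandleAll-invariant I []       = I
  HandleAll-invariant I (h ∷ hs) = HandleAll-invariant (Handle-invariant I h) hs

  Steps-invariant : ∀ {st st'} → Invariant st → Steps st st' → Invariant st'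
  Steps-invariant I done = I
  Steps-invariant {st} I (more (step {l1 = l} {l1' = l'} _ _ _ hs) ss) =
    Steps-invariant (HandleAll-invariant I′ hs) ss
    where
      I′ : Invariant (removeW st (l , l'))
      I′ = record { edges-wellFormed = edges-wellFormed I ; visited-∉Δ = visited-∉Δ I }

  Eout-wellFormed : ∀ {st l l' g n} → Invariant st → Eout st (pair l l') g n →
    WellFormedTarget l g n × InN st n
  Eout-wellFormed I (_ , _ , n∈N , inj₁ e) = edges-wellFormed I e , n∈N
  Eout-wellFormed I (_ , _ , m∈Δ , inj₂ (_ , refl , _ , _ , e)) with edges-wellFormed I e
  ... | pair m≡tgt _ = single m≡tgt , m∈Δ

  wellFormed-unique : State → ∀ {st l g n₁ n₂} → Invariant st →
    WellFormedTarget l g n₁ × InN st n₁ → WellFormedTarget l g n₂ × InN st n₂ → n₁ ≡ n₂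
  wellFormed-unique _ I (single m₁≡ , _) (single m₂≡ , _) = cong single (trans m₁≡ (sym m₂≡))
  wellFormed-unique _ {st} I (single m₁≡ , m₁∈Δ) (pair m₂≡ _ , v) =
    ⊥-elim (visited-∉Δ I v (subst (Δ st) (trans m₁≡ (sym m₂≡)) m₁∈Δ))
  wellFormed-unique _ {st} I (pair m₁≡ _ , v) (single m₂≡ , m₂∈Δ) =
    ⊥-elim (visited-∉Δ I v (subst (Δ st) (trans m₂≡ (sym m₁≡)) m₂∈Δ))
  wellFormed-unique c I (pair m₁≡ s₁ , _) (pair m₂≡ s₂ , _) =
    cong₂ pair (Successor-functional c s₁ s₂) (trans m₁≡ (sym m₂≡))

  Eout-functional : State → ∀ {st} → Invariant st → Functional (Eout st)
  Eout-functional c I {pair _ _} e₁ e₂ =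
    wellFormed-unique c I (Eout-wellFormed I e₁) (Eout-wellFormed I e₂)

  Output-functional : State → ∀ {n₀ E} → Output n₀ E → Functional E
  Output-functional _ (_ , _ , _ , trivial _) ()
  Output-functional c (_ , run , _ , graph _) = Eout-functional c (Steps-invariant init-invariant run)

lemma1 : (𝓛 : Lang) (P P' : CFA 𝓛) → Deterministic P → Deterministic P' →
    (n₀ : DD.Node P P') (E : DD.Node P P' → DD.E' P P' → DD.Node P P' → Set) →
    DD.Output P P' n₀ E →
    (c₀ : Lang.State 𝓛) (gs : List (DD.E' P P')) → RB P P' c₀ gs →
    (k : ℕ) → k ≤ length gs →
    (ns ns' : ℕ → DD.Node P P') → ns 0 ≡ n₀ → ns' 0 ≡ n₀ →
    (∀ (i : Fin (length gs)) → toℕ i < k → E (ns (toℕ i)) (lookup gs i) (ns (suc (toℕ i)))) →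
    (∀ (i : Fin (length gs)) → toℕ i < k → E (ns' (toℕ i)) (lookup gs i) (ns' (suc (toℕ i)))) →
    (i : ℕ) → i ≤ k → ns i ≡ ns' i
lemma1 𝓛 P P' P-det _ n₀ E out c₀ gs _ k k≤len ns ns' ns₀≡n₀ ns'₀≡n₀ walk walk' =
  functional-walks-agree {E = E} (Output-functional P P' P-det c₀ out) gs k≤len ns ns'
    (trans ns₀≡n₀ (sym ns'₀≡n₀)) walk walk'
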